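{- Let $n$ be a positive multiple of $8$ such that $l=n-1$ is squarefree, and let $W$ be a real $n\times n$ skew-symmetric matrix with zero diagonal, off-diagonal entries in $\{ -1,1\}$ and $WW^\top=(n-1)I$. Let $\mathcal{O}=\mathbf{Z}[\frac{1+\sqrt{ -l}}{2}]$ act on $\mathbf{R}^n$ via $(r+s\sqrt{ -l})\mathbf{v}=\mathbf{v}(rI+sW)$. Let $L_0=\{(a_1,\ldots,a_n)\in\mathbf{Z}^n:\sum a_j\equiv0\pmod2\}$, and let $\mathbf{e}_1$ be the first unit vector. Define $L_+=L_0\cup\big(\tfrac12\mathbf{e}_1(I+W)+L_0\big)$ and $L_-=L_0\cup\big(\tfrac12\mathbf{e}_1(-I+W)+L_0\big)$. Then $L_+$ and $L_-$ are $\mathcal{O}$-modules.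
   Context: $L_+$ and $L_-$ are lattices (each isometric to $D_n^+$); vectors are row vectors. -}

module Defs where

open import Data.Nat as ℕ using (ℕ; _∸_)
open import Data.Nat.Divisibility using (_∣_)
open import Data.Integer as ℤ using (ℤ)
open import Data.Integer.Divisibility as ℤD using ()
open import Data.Fin using (Fin; toℕ)
open import Data.Product using (Σ; ∃; _×_)
open import Data.Sum using (_⊎_)
open import Relation.Binary.PropositionalEquality using (_≡_)
open import Relation.Nullary using (¬_)
open import Data.Rational as ℚ using (ℚ; 0ℚ; 1ℚ; ½; _+_; _*_; _-_; -_)

Vecℚ : ℕ → Set
Vecℚ n = Fin n → ℚ

Matℚ : ℕ → Set
Matℚ n = Fin n → Fin n → ℚ

Σℚ : (n : ℕ) → (Fin n → ℚ) → ℚ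
Σℚ ℕ.zero f = 0ℚ
Σℚ (ℕ.suc n) f = f Fin.zero + Σℚ n (λ i → f (Fin.suc i))
  where import Data.Fin as Fin

Σℤ : (n : ℕ) → (Fin n → ℤ) → ℤ
Σℤ ℕ.zero f = ℤ.0ℤ
Σℤ (ℕ.suc n) f = f Fin.zero ℤ.+ Σℤ n (λ i → f (Fin.suc i))
  where import Data.Fin as Fin

δ : {n : ℕ} → Fin n → Fin n → ℚ
δ i j with toℕ i ℕ.≟ toℕ j
... | Relation.Nullary.yes _ = 1ℚ
... | Relation.Nullary.no _ = 0ℚ
  where import Relation.Nullary

I : (n : ℕ) → Matℚ n
I n = δ

_·M_ : {n : ℕ} → Vecℚ n → Matℚ n → Vecℚ n
_·M_ {n} v M j = Σℚ n (λ i → v i * M i j)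

_+M_ : {n : ℕ} → Matℚ n → Matℚ n → Matℚ n
(A +M B) i j = A i j + B i j

_•M_ : {n : ℕ} → ℚ → Matℚ n → Matℚ n
(c •M A) i j = c * A i j

_+V_ : {n : ℕ} → Vecℚ n → Vecℚ n → Vecℚ n
(u +V v) i = u i + v i

_-V_ : {n : ℕ} → Vecℚ n → Vecℚ n → Vecℚ n
(u -V v) i = u i - v i

_•V_ : {n : ℕ} → ℚ → Vecℚ n → Vecℚ n
(c •V v) i = c * v i

zeroV : {n : ℕ} → Vecℚ n
zeroV i = 0ℚ

e₁ : {n : ℕ} → Vecℚ n
e₁ i with toℕ i
... | ℕ.zero = 1ℚ
... | ℕ.suc _ = 0ℚ

Squarefree : ℕ → Set
Squarefree m = ∀ d → d ℕ.* d ∣ m → d ≡ 1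

IsConferenceW : (n : ℕ) → Matℚ n → Set
IsConferenceW n W =
  (∀ i j → W j i ≡ - W i j) ×
  (∀ i → W i i ≡ 0ℚ) ×
  (∀ i j → ¬ (toℕ i ≡ toℕ j) → (W i j ≡ 1ℚ ⊎ W i j ≡ - 1ℚ)) ×
  (∀ i j → Σℚ n (λ k → W i k * W j k) ≡ (ℤ.+ (n ∸ 1) ℚ./ 1) * δ i j)

L₀ : (n : ℕ) → Vecℚ n → Set
L₀ n v = Σ (Fin n → ℤ) λ a → (∀ i → v i ≡ a i ℚ./ 1) × (ℤ.+ 2 ℤD.∣ Σℤ n a)

L₊ : (n : ℕ) → Matℚ n → Vecℚ n → Set
L₊ n W v = L₀ n v ⊎ L₀ n (v -V (½ •V (e₁ ·M (I n +M W))))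

L₋ : (n : ℕ) → Matℚ n → Vecℚ n → Set
L₋ n W v = L₀ n v ⊎ L₀ n (v -V (½ •V (e₁ ·M (((- 1ℚ) •M I n) +M W))))

-- 𝒪 = ℤ[(1+√-l)/2] = { a + b(1+√-l)/2 : a b ∈ ℤ }; the element
-- r + s√-l (r = a + b/2, s = b/2) acts by v ↦ v (rI + sW).
actO : (n : ℕ) → Matℚ n → ℤ → ℤ → Vecℚ n → Vecℚ n
actO n W a b v = v ·M ((r •M I n) +M (s •M W))
  where
  s : ℚ
  s = b ℚ./ 2
  r : ℚ
  r = (a ℚ./ 1) + s

-- A subset L of ℝⁿ (here ℚⁿ) is an 𝒪-module: an additive subgroup
-- (contains 0, closed under +; negation is the action of -1 ∈ 𝒪)
-- closed under the action of every element of 𝒪.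
IsOModule : (n : ℕ) → Matℚ n → (Vecℚ n → Set) → Set
IsOModule n W L =
  L zeroV ×
  (∀ u v → L u → L v → L (u +V v)) ×
  (∀ a b v → L v → L (actO n W a b v))

-- The element a + b(1+√−l)/2 of 𝒪 acts as v ↦ a v + b · v(I+W)/2, and L (= L₊ or L₋) is the
-- additive group L₀ + ℤ · ½c with c = ±e₁ + e₁W, so it suffices that L is stable under
-- v ↦ v(I+W)/2. For u ∈ L₀ this holds because J − I − W has even entries: hence
-- u(I+W) ≡ (Σ u)·𝟙 (mod 2), and since products of two rows of J − I − W are ≡ 0 (mod 4) while W has
-- orthogonal rows, all row sums of W are odd and congruent mod 4, which makes the coordinate sum of
-- u(I+W)/2 even. For the glue vector, W² = −(n−1)I gives c(I+W) = (1 ± 1)c − n e₁, and 8 ∣ n puts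
-- (n/4)e₁ into L₀.

module Submission where

open import Defs
open import Data.Nat using (ℕ; _∸_; _<_)
open import Data.Nat.Divisibility using (_∣_)
open import Data.Product using (_×_)

open import Data.Fin using (Fin; zero; suc; toℕ)
import Data.Fin.Properties as FinP
open import Data.Integer as ℤ using (ℤ; +_; -[1+_]; 0ℤ; 1ℤ; -1ℤ; _+_; _*_; _-_; -_)
open import Data.Integer.Divisibility.Signed
  using (divides; quotient; ∣ᵤ⇒∣; ∣⇒∣ᵤ; ∣-trans; ∣m∣n⇒∣m+n; ∣m∣n⇒∣m-n; ∣m⇒∣m*n; ∣n⇒∣m*n; *-monoˡ-∣; *-monoʳ-∣; *-cancelˡ-∣)
  renaming (_∣_ to _∣ℤ_)
open import Data.Integer.DivMod using (_%ℕ_; _/ℕ_; n%ℕd<d; a≡a%ℕn+[a/ℕn]*n)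
import Data.Integer.Properties as ℤP
import Data.Integer.Divisibility as ℤ∣ᵘ
open import Algebra.Properties.Semiring.Sum ℤP.+-*-semiring
  using (sum; sum-syntax; sum-cong-≗; ∑-distrib-+; ∑-comm; *-distribˡ-sum; sum-replicate-zero)
open import Data.Integer.Tactic.RingSolver using (solve-∀)
open import Data.Nat as ℕ using (s≤s)
open import Data.Nat.Coprimality as Coprimality using (1-coprimeTo)
open import Data.Product using (∃; ∃₂; _,_; proj₁; proj₂)
open import Data.Rational as ℚ using (ℚ; ½; 0ℚ; 1ℚ; ↥_)
import Data.Rational.Properties as ℚP
open import Data.Sum using (_⊎_; inj₁; inj₂)
open import Data.Vec.Functional using (Vector)
open import Function using (_∘_)
open import Relation.Binary.PropositionalEquality
open import Relation.Nullary using (yes; no; ¬_; contradiction)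
open import Relation.Nullary.Decidable using (dec⇒maybe)
import Tactic.RingSolver as RingSolver
import Tactic.RingSolver.Core.AlmostCommutativeRing as ACR

open ≡-Reasoning

ι : ℤ → ℚ
ι z = z ℚ./ 1

ι≡mkℚ : ∀ z → ι z ≡ ℚ.mkℚ z 0 (Coprimality.sym (1-coprimeTo ℤ.∣ z ∣))
ι≡mkℚ (+ n)    = ℚP.normalize-coprime (Coprimality.sym (1-coprimeTo n))
ι≡mkℚ -[1+ n ] = cong ℚ.-_ (ℚP.normalize-coprime (Coprimality.sym (1-coprimeTo (ℕ.suc n))))

↥-ι : ∀ z → ↥ ι z ≡ z
↥-ι z = cong ↥_ (ι≡mkℚ z)

ι-injective : ∀ {a b} → ι a ≡ ι b → a ≡ b
ι-injective {a} {b} eq = trans (sym (↥-ι a)) (trans (cong ↥_ eq) (↥-ι b))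

ι-+ : ∀ a b → ι (a + b) ≡ ι a ℚ.+ ι b
ι-+ a b rewrite ι≡mkℚ a | ι≡mkℚ b =
  cong (ℚ._/ 1) (sym (cong₂ _+_ (ℤP.*-identityʳ a) (ℤP.*-identityʳ b)))

ι-* : ∀ a b → ι (a * b) ≡ ι a ℚ.* ι b
ι-* a b rewrite ι≡mkℚ a | ι≡mkℚ b = refl

ι-↥ : ∀ {q} → q ≡ 1ℚ ⊎ q ≡ ℚ.- 1ℚ → ι (↥ q) ≡ q
ι-↥ (inj₁ refl) = refl
ι-↥ (inj₂ refl) = refl

/2≡½*ι : ∀ z → z ℚ./ 2 ≡ ½ ℚ.* ι z
/2≡½*ι z rewrite ι≡mkℚ z = cong (ℚ._/ 2) (sym (ℤP.*-identityˡ z))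

½*ι[2*] : ∀ z → ½ ℚ.* ι (+ 2 * z) ≡ ι z
½*ι[2*] z = begin
  ½ ℚ.* ι (+ 2 * z)        ≡⟨ cong (½ ℚ.*_) (ι-* (+ 2) z) ⟩
  ½ ℚ.* (ι (+ 2) ℚ.* ι z)  ≡⟨ ℚP.*-assoc ½ (ι (+ 2)) (ι z) ⟨
  1ℚ ℚ.* ι z               ≡⟨ ℚP.*-identityˡ (ι z) ⟩
  ι z                      ∎

ℚ-ring : ACR.AlmostCommutativeRing _ _
ℚ-ring = ACR.fromCommutativeRing ℚP.+-*-commutativeRing (λ q → dec⇒maybe (0ℚ ℚP.≟ q))

sub≡⇒≡+ : ∀ {v h y} → v ℚ.- h ≡ y → v ≡ h ℚ.+ y
sub≡⇒≡+ {v} {h} v-h≡y = trans (split v h) (cong (h ℚ.+_) v-h≡y)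
  where
  split : ∀ v h → v ≡ h ℚ.+ (v ℚ.+ ℚ.- h)
  split = RingSolver.solve-∀ ℚ-ring

≡+⇒sub≡ : ∀ {v h y} → v ≡ h ℚ.+ y → v ℚ.- h ≡ y
≡+⇒sub≡ {v} {h} {y} v≡h+y = trans (cong (ℚ._- h) v≡h+y) (cancel h y)
  where
  cancel : ∀ h y → h ℚ.+ y ℚ.+ ℚ.- h ≡ y
  cancel = RingSolver.solve-∀ ℚ-ring

δℤ : ∀ {n} → Fin n → Fin n → ℤ
δℤ zero    zero    = 1ℤ
δℤ zero    (suc _) = 0ℤ
δℤ (suc _) zero    = 0ℤ
δℤ (suc i) (suc j) = δℤ i j

δℤ-diag : ∀ {n} (i : Fin n) → δℤ i i ≡ 1ℤ
δℤ-diag zero    = refl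
δℤ-diag (suc i) = δℤ-diag i

δℤ-off : ∀ {n} {i j : Fin n} → i ≢ j → δℤ i j ≡ 0ℤ
δℤ-off {i = zero}  {zero}  i≢j = contradiction refl i≢j
δℤ-off {i = zero}  {suc j} i≢j = refl
δℤ-off {i = suc i} {zero}  i≢j = refl
δℤ-off {i = suc i} {suc j} i≢j = δℤ-off (i≢j ∘ cong suc)

δℤ-sym : ∀ {n} (i j : Fin n) → δℤ i j ≡ δℤ j i
δℤ-sym zero    zero    = refl
δℤ-sym zero    (suc j) = refl
δℤ-sym (suc i) zero    = refl
δℤ-sym (suc i) (suc j) = δℤ-sym i j

δ≡ιδℤ : ∀ {n} (i j : Fin n) → δ i j ≡ ι (δℤ i j)
δ≡ιδℤ i j with toℕ i ℕ.≟ toℕ j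
... | yes i≡j rewrite FinP.toℕ-injective i≡j | δℤ-diag j = refl
... | no  i≢j rewrite δℤ-off (i≢j ∘ cong toℕ) = refl

Σℤ≡sum : ∀ n (f : Vector ℤ n) → Σℤ n f ≡ sum f
Σℤ≡sum ℕ.zero    f = refl
Σℤ≡sum (ℕ.suc n) f = cong (λ s → f zero + s) (Σℤ≡sum n (f ∘ suc))

Σℚ-cong : ∀ n {f g : Vecℚ n} → (∀ i → f i ≡ g i) → Σℚ n f ≡ Σℚ n g
Σℚ-cong ℕ.zero    f≗g = refl
Σℚ-cong (ℕ.suc n) f≗g = cong₂ ℚ._+_ (f≗g zero) (Σℚ-cong n (f≗g ∘ suc))

Σℚ-*ˡ : ∀ n q (f : Vecℚ n) → Σℚ n (λ i → q ℚ.* f i) ≡ q ℚ.* Σℚ n f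
Σℚ-*ˡ ℕ.zero    q f = sym (ℚP.*-zeroʳ q)
Σℚ-*ˡ (ℕ.suc n) q f = begin
  q ℚ.* f zero ℚ.+ Σℚ n (λ i → q ℚ.* f (suc i)) ≡⟨ cong (q ℚ.* f zero ℚ.+_) (Σℚ-*ˡ n q (f ∘ suc)) ⟩
  q ℚ.* f zero ℚ.+ q ℚ.* Σℚ n (f ∘ suc)         ≡⟨ ℚP.*-distribˡ-+ q (f zero) _ ⟨
  q ℚ.* (f zero ℚ.+ Σℚ n (f ∘ suc))             ∎

Σℚ-ι : ∀ n (f : Vector ℤ n) → Σℚ n (ι ∘ f) ≡ ι (sum f)
Σℚ-ι ℕ.zero    f = refl
Σℚ-ι (ℕ.suc n) f = trans (cong (ι (f zero) ℚ.+_) (Σℚ-ι n (f ∘ suc))) (sym (ι-+ (f zero) _))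

Σℚ-e₁ : ∀ n (f : Vecℚ (ℕ.suc n)) → Σℚ (ℕ.suc n) (λ i → e₁ i ℚ.* f i) ≡ f zero
Σℚ-e₁ n f = begin
  1ℚ ℚ.* f zero ℚ.+ Σℚ n (λ i → 0ℚ ℚ.* f (suc i)) ≡⟨ cong₂ ℚ._+_ (ℚP.*-identityˡ (f zero)) (Σℚ-*ˡ n 0ℚ (f ∘ suc)) ⟩
  f zero ℚ.+ 0ℚ ℚ.* Σℚ n (f ∘ suc)               ≡⟨ cong (f zero ℚ.+_) (ℚP.*-zeroˡ (Σℚ n (f ∘ suc))) ⟩
  f zero ℚ.+ 0ℚ                                  ≡⟨ ℚP.+-identityʳ (f zero) ⟩
  f zero                                         ∎

∑-*ˡ : ∀ {n} c (f : Vector ℤ n) → ∑[ i < n ] (c * f i) ≡ c * sum f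
∑-*ˡ c f = sym (*-distribˡ-sum c f)

∑-linear : ∀ {n} a b (f g : Vector ℤ n) →
  ∑[ i < n ] (a * f i + b * g i) ≡ a * sum f + b * sum g
∑-linear a b f g = trans (∑-distrib-+ (λ i → a * f i) (λ i → b * g i)) (cong₂ _+_ (∑-*ˡ a f) (∑-*ˡ b g))

∑-neg : ∀ {n} (f : Vector ℤ n) → ∑[ i < n ] (- f i) ≡ - sum f
∑-neg f = trans (sum-cong-≗ (λ i → sym (ℤP.-1*i≡-i (f i)))) (trans (∑-*ˡ -1ℤ f) (ℤP.-1*i≡-i _))

∑-distrib-- : ∀ {n} (f g : Vector ℤ n) → ∑[ i < n ] (f i - g i) ≡ sum f - sum g
∑-distrib-- f g = trans (∑-distrib-+ f (-_ ∘ g)) (cong (λ s → sum f + s) (∑-neg g))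

∑-one : ∀ n → ∑[ i < n ] 1ℤ ≡ + n
∑-one ℕ.zero    = refl
∑-one (ℕ.suc n) = cong (λ s → 1ℤ + s) (∑-one n)

∑-δ : ∀ {n} (i : Fin n) (f : Vector ℤ n) → ∑[ k < n ] (δℤ i k * f k) ≡ f i
∑-δ {ℕ.suc n} zero    f = trans (cong₂ _+_ (ℤP.*-identityˡ (f zero)) (sum-replicate-zero n)) (ℤP.+-identityʳ (f zero))
∑-δ {ℕ.suc n} (suc i) f = trans (ℤP.+-identityˡ _) (∑-δ i (f ∘ suc))

∑-δ≡1 : ∀ {n} (i : Fin n) → ∑[ k < n ] δℤ i k ≡ 1ℤ
∑-δ≡1 i = trans (sum-cong-≗ (λ k → sym (ℤP.*-identityʳ (δℤ i k)))) (∑-δ i (λ _ → 1ℤ))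

∑-δᵀ : ∀ {n} (j : Fin n) (f : Vector ℤ n) → ∑[ k < n ] (δℤ k j * f k) ≡ f j
∑-δᵀ j f = trans (sum-cong-≗ (λ k → cong (_* f k) (δℤ-sym k j))) (∑-δ j f)

∑-divisible : ∀ {n d} (f : Vector ℤ n) → (∀ i → d ∣ℤ f i) → d ∣ℤ sum f
∑-divisible {ℕ.zero}  f d∣f = divides 0ℤ refl
∑-divisible {ℕ.suc n} f d∣f = ∣m∣n⇒∣m+n (d∣f zero) (∑-divisible (f ∘ suc) (d∣f ∘ suc))

even-sum⇒∣ : ∀ {n} (u : Vector ℤ n) → + 2 ℤ∣ᵘ.∣ Σℤ n u → + 2 ∣ℤ sum u
even-sum⇒∣ {n} u 2∣Σu = subst (+ 2 ∣ℤ_) (Σℤ≡sum n u) (∣ᵤ⇒∣ 2∣Σu)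

∣⇒even-sum : ∀ {n} (u : Vector ℤ n) → + 2 ∣ℤ sum u → + 2 ℤ∣ᵘ.∣ Σℤ n u
∣⇒even-sum {n} u 2∣Σu = ∣⇒∣ᵤ (subst (+ 2 ∣ℤ_) (sym (Σℤ≡sum n u)) 2∣Σu)

*-pres-∣ : ∀ {i j a b} → i ∣ℤ a → j ∣ℤ b → i * j ∣ℤ a * b
*-pres-∣ {j = j} {a} i∣a j∣b = ∣-trans (*-monoˡ-∣ j i∣a) (*-monoʳ-∣ a j∣b)

even-or-odd : ∀ t → t ≡ (t /ℕ 2) * + 2 ⊎ t ≡ 1ℤ + (t /ℕ 2) * + 2
even-or-odd t with t %ℕ 2 | n%ℕd<d t 2 | a≡a%ℕn+[a/ℕn]*n t 2
... | 0               | _               | t≡ = inj₁ (trans t≡ (ℤP.+-identityˡ _))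
... | 1               | _               | t≡ = inj₂ t≡
... | ℕ.suc (ℕ.suc _) | s≤s (s≤s ())    | _

_·ᶻ_ : ∀ {n} → Vector ℤ n → (Fin n → Fin n → ℤ) → Vector ℤ n
_·ᶻ_ {n} x w j = ∑[ i < n ] (x i * w i j)

·ᶻ-linear : ∀ {n} (w : Fin n → Fin n → ℤ) a b {x y z : Vector ℤ n} →
  (∀ i → x i ≡ a * y i + b * z i) → ∀ j → (x ·ᶻ w) j ≡ a * (y ·ᶻ w) j + b * (z ·ᶻ w) j
·ᶻ-linear {n} w a b {x} {y} {z} x≡ j = begin
  ∑[ i < n ] (x i * w i j)                             ≡⟨ sum-cong-≗ (λ i → cong (_* w i j) (x≡ i)) ⟩
  ∑[ i < n ] ((a * y i + b * z i) * w i j)             ≡⟨ sum-cong-≗ (λ i → distrib a b (y i) (z i) (w i j)) ⟩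
  ∑[ i < n ] (a * (y i * w i j) + b * (z i * w i j))   ≡⟨ ∑-linear a b (λ i → y i * w i j) (λ i → z i * w i j) ⟩
  a * (y ·ᶻ w) j + b * (z ·ᶻ w) j                      ∎
  where
  distrib : ∀ a b y z v → (a * y + b * z) * v ≡ a * (y * v) + b * (z * v)
  distrib = solve-∀

·[J-I-M] : ∀ {n} (v : Fin n → Fin n → ℤ) (f : Vector ℤ n) j →
  ∑[ i < n ] (f i * (1ℤ - δℤ i j - v i j)) ≡ sum f - f j - (f ·ᶻ v) j
·[J-I-M] {n} v f j = begin
  ∑[ i < n ] (f i * (1ℤ - δℤ i j - v i j))
    ≡⟨ sum-cong-≗ (λ i → expand (f i) (δℤ i j) (v i j)) ⟩
  ∑[ i < n ] ((f i - δℤ i j * f i) - f i * v i j)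
    ≡⟨ ∑-distrib-- (λ i → f i - δℤ i j * f i) (λ i → f i * v i j) ⟩
  ∑[ i < n ] (f i - δℤ i j * f i) - (f ·ᶻ v) j
    ≡⟨ cong (_- (f ·ᶻ v) j) (trans (∑-distrib-- f (λ i → δℤ i j * f i)) (cong (λ s → sum f - s) (∑-δᵀ j f))) ⟩
  sum f - f j - (f ·ᶻ v) j ∎
  where
  expand : ∀ x d v → x * (1ℤ - d - v) ≡ (x - d * x) - x * v
  expand = solve-∀

-- The action of 𝒪 on half-integral vectors
half : ∀ {n} → Vector ℤ n → Vecℚ n
half x j = ½ ℚ.* ι (x j)

half-+ : ∀ {n} (x y : Vector ℤ n) j → half x j ℚ.+ half y j ≡ half (λ k → x k + y k) j
half-+ x y j = begin
  ½ ℚ.* ι (x j) ℚ.+ ½ ℚ.* ι (y j)  ≡⟨ ℚP.*-distribˡ-+ ½ (ι (x j)) (ι (y j)) ⟨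
  ½ ℚ.* (ι (x j) ℚ.+ ι (y j))      ≡⟨ cong (½ ℚ.*_) (ι-+ (x j) (y j)) ⟨
  ½ ℚ.* ι (x j + y j)              ∎

half[c+2u] : ∀ {n} (c u : Vector ℤ n) j → half (λ k → c k + + 2 * u k) j ≡ half c j ℚ.+ ι (u j)
half[c+2u] c u j = trans (sym (half-+ c (λ k → + 2 * u k) j)) (cong (half c j ℚ.+_) (½*ι[2*] (u j)))

actO-cong : ∀ {n} (W : Matℚ n) a b {u v : Vecℚ n} → (∀ i → u i ≡ v i) → ∀ j → actO n W a b u j ≡ actO n W a b v j
actO-cong {n} W a b u≗v j =
  Σℚ-cong n (λ i → cong (ℚ._* ((ι a ℚ.+ b ℚ./ 2) ℚ.* δ i j ℚ.+ (b ℚ./ 2) ℚ.* W i j)) (u≗v i))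

actO-half : ∀ {n} (W : Matℚ n) (w : Fin n → Fin n → ℤ) → (∀ i j → W i j ≡ ι (w i j)) →
  ∀ {x y : Vector ℤ n} → (∀ j → x j + (x ·ᶻ w) j ≡ + 2 * y j) →
  ∀ a b j → actO n W a b (half x) j ≡ half (λ k → a * x k + b * y k) j
actO-half {n} W w W≡ιw {x} {y} x+x·w≡2y a b j = begin
  actO n W a b (half x) j                        ≡⟨ Σℚ-cong n term ⟩
  Σℚ n (λ i → (½ ℚ.* ½) ℚ.* ι (g i))             ≡⟨ Σℚ-*ˡ n (½ ℚ.* ½) (ι ∘ g) ⟩
  (½ ℚ.* ½) ℚ.* Σℚ n (ι ∘ g)                      ≡⟨ cong ((½ ℚ.* ½) ℚ.*_) (trans (Σℚ-ι n g) (cong ι ∑g≡2[ax+by])) ⟩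
  (½ ℚ.* ½) ℚ.* ι (+ 2 * (a * x j + b * y j))    ≡⟨ ℚP.*-assoc ½ ½ (ι (+ 2 * (a * x j + b * y j))) ⟩
  ½ ℚ.* (½ ℚ.* ι (+ 2 * (a * x j + b * y j)))    ≡⟨ cong (½ ℚ.*_) (½*ι[2*] (a * x j + b * y j)) ⟩
  half (λ k → a * x k + b * y k) j               ∎
  where
  g : Vector ℤ n
  g i = δℤ i j * ((a + a + b) * x i) + b * (x i * w i j)

  regroup : ∀ a b x z y → (a + a + b) * x + b * z ≡ (a + a) * x + b * (x + z)
  regroup = solve-∀
  collect : ∀ a b x y → (a + a) * x + b * (+ 2 * y) ≡ + 2 * (a * x + b * y)
  collect = solve-∀

  ∑g≡2[ax+by] : sum g ≡ + 2 * (a * x j + b * y j)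
  ∑g≡2[ax+by] = begin
    sum g                                      ≡⟨ ∑-distrib-+ (λ i → δℤ i j * ((a + a + b) * x i)) (λ i → b * (x i * w i j)) ⟩
    ∑[ i < n ] (δℤ i j * ((a + a + b) * x i)) + ∑[ i < n ] (b * (x i * w i j))
      ≡⟨ cong₂ _+_ (∑-δᵀ j (λ i → (a + a + b) * x i)) (∑-*ˡ b (λ i → x i * w i j)) ⟩
    (a + a + b) * x j + b * (x ·ᶻ w) j         ≡⟨ regroup a b (x j) ((x ·ᶻ w) j) (y j) ⟩
    (a + a) * x j + b * (x j + (x ·ᶻ w) j)     ≡⟨ cong (λ s → (a + a) * x j + b * s) (x+x·w≡2y j) ⟩
    (a + a) * x j + b * (+ 2 * y j)            ≡⟨ collect a b (x j) (y j) ⟩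
    + 2 * (a * x j + b * y j)                  ∎

  ι-g : ∀ i → ι (g i) ≡ ι (δℤ i j) ℚ.* ((ι a ℚ.+ ι a ℚ.+ ι b) ℚ.* ι (x i)) ℚ.+ ι b ℚ.* (ι (x i) ℚ.* ι (w i j))
  ι-g i rewrite ι-+ (δℤ i j * ((a + a + b) * x i)) (b * (x i * w i j))
              | ι-* (δℤ i j) ((a + a + b) * x i) | ι-* (a + a + b) (x i) | ι-+ (a + a) b | ι-+ a a
              | ι-* b (x i * w i j) | ι-* (x i) (w i j) = refl

  -- h + h stands for ½ + ½ = 1, which the solver does not know.
  halves : ∀ h X A B D V →
    (h ℚ.* X) ℚ.* (((h ℚ.+ h) ℚ.* A ℚ.+ h ℚ.* B) ℚ.* D ℚ.+ (h ℚ.* B) ℚ.* V)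
      ≡ (h ℚ.* h) ℚ.* (D ℚ.* ((A ℚ.+ A ℚ.+ B) ℚ.* X) ℚ.+ B ℚ.* (X ℚ.* V))
  halves = RingSolver.solve-∀ ℚ-ring

  term : ∀ i → half x i ℚ.* ((ι a ℚ.+ b ℚ./ 2) ℚ.* δ i j ℚ.+ (b ℚ./ 2) ℚ.* W i j) ≡ (½ ℚ.* ½) ℚ.* ι (g i)
  term i rewrite /2≡½*ι b | δ≡ιδℤ i j | W≡ιw i j | ι-g i =
    trans (cong (λ A → ½ ℚ.* ι (x i) ℚ.* ((A ℚ.+ ½ ℚ.* ι b) ℚ.* ι (δℤ i j) ℚ.+ (½ ℚ.* ι b) ℚ.* ι (w i j)))
                (sym (ℚP.*-identityˡ (ι a))))
          (halves ½ (ι (x i)) (ι a) (ι b) (ι (δℤ i j)) (ι (w i j)))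

-- Integral skew conference matrices
module ConferenceMatrix {n : ℕ} (w : Fin n → Fin n → ℤ)
  (w-skew   : ∀ i j → w j i ≡ - w i j)
  (w-parity : ∀ i j → + 2 ∣ℤ 1ℤ - δℤ i j - w i j)
  (w-gram   : ∀ i j → ∑[ k < n ] (w i k * w j k) ≡ (+ n - 1ℤ) * δℤ i j)
  where

  rowSum : Fin n → ℤ
  rowSum i = sum (w i)

  ∑-*[J-I-W]-row : ∀ i (f : Vector ℤ n) →
    ∑[ k < n ] (f k * (1ℤ - δℤ i k - w i k)) ≡ sum f - f i - ∑[ k < n ] (f k * w i k)
  ∑-*[J-I-W]-row i f =
    trans (sum-cong-≗ (λ k → cong (λ d → f k * (1ℤ - d - w i k)) (δℤ-sym i k))) (·[J-I-M] (λ k j → w j k) f i)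

  ∑[J-I-W]-row : ∀ i → ∑[ k < n ] (1ℤ - δℤ i k - w i k) ≡ + n - 1ℤ - rowSum i
  ∑[J-I-W]-row i = begin
    ∑[ k < n ] (1ℤ - δℤ i k - w i k)          ≡⟨ sum-cong-≗ {n} (λ k → ℤP.*-identityˡ (1ℤ - δℤ i k - w i k)) ⟨
    ∑[ k < n ] (1ℤ * (1ℤ - δℤ i k - w i k))   ≡⟨ ∑-*[J-I-W]-row i (λ _ → 1ℤ) ⟩
    ∑[ k < n ] 1ℤ - 1ℤ - ∑[ k < n ] (1ℤ * w i k)
      ≡⟨ cong₂ (λ s t → s - 1ℤ - t) (∑-one n) (sum-cong-≗ (λ k → ℤP.*-identityˡ (w i k))) ⟩
    + n - 1ℤ - rowSum i                       ∎

  rowSum-odd : + 2 ∣ℤ + n → ∀ i → + 2 ∣ℤ rowSum i + 1ℤ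
  rowSum-odd 2∣n i = subst (+ 2 ∣ℤ_) n-∑≡R+1
    (∣m∣n⇒∣m-n 2∣n (∑-divisible (λ k → 1ℤ - δℤ i k - w i k) (w-parity i)))
    where
    simplify : ∀ n r → n - (n - 1ℤ - r) ≡ r + 1ℤ
    simplify = solve-∀
    n-∑≡R+1 : + n - ∑[ k < n ] (1ℤ - δℤ i k - w i k) ≡ rowSum i + 1ℤ
    n-∑≡R+1 = trans (cong (λ s → + n - s) (∑[J-I-W]-row i)) (simplify (+ n) (rowSum i))

  ∑[J-I-W]²-rows : ∀ {i j} → i ≢ j →
    ∑[ k < n ] ((1ℤ - δℤ i k - w i k) * (1ℤ - δℤ j k - w j k)) ≡ + n - + 2 - rowSum i - rowSum j
  ∑[J-I-W]²-rows {i} {j} i≢j = begin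
    ∑[ k < n ] ((1ℤ - δℤ i k - w i k) * (1ℤ - δℤ j k - w j k))
      ≡⟨ ∑-*[J-I-W]-row j (λ k → 1ℤ - δℤ i k - w i k) ⟩
    ∑[ k < n ] (1ℤ - δℤ i k - w i k) - (1ℤ - δℤ i j - w i j) - ∑[ k < n ] ((1ℤ - δℤ i k - w i k) * w j k)
      ≡⟨ cong₂ (λ s t → s - (1ℤ - δℤ i j - w i j) - t) (∑[J-I-W]-row i) ∑[J-I-W]w ⟩
    (+ n - 1ℤ - rowSum i) - (1ℤ - δℤ i j - w i j) - (rowSum j - w j i - (+ n - 1ℤ) * δℤ j i)
      ≡⟨ eliminate (δℤ-off i≢j) (δℤ-off (i≢j ∘ sym)) (w-skew i j) ⟩
    + n - + 2 - rowSum i - rowSum j ∎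
    where
    ∑[J-I-W]w : ∑[ k < n ] ((1ℤ - δℤ i k - w i k) * w j k) ≡ rowSum j - w j i - (+ n - 1ℤ) * δℤ j i
    ∑[J-I-W]w = begin
      ∑[ k < n ] ((1ℤ - δℤ i k - w i k) * w j k)   ≡⟨ sum-cong-≗ (λ k → ℤP.*-comm (1ℤ - δℤ i k - w i k) (w j k)) ⟩
      ∑[ k < n ] (w j k * (1ℤ - δℤ i k - w i k))   ≡⟨ ∑-*[J-I-W]-row i (w j) ⟩
      rowSum j - w j i - ∑[ k < n ] (w j k * w i k) ≡⟨ cong (λ s → rowSum j - w j i - s) (w-gram j i) ⟩
      rowSum j - w j i - (+ n - 1ℤ) * δℤ j i        ∎
    arith : ∀ n r s x → (n - 1ℤ - r) - (1ℤ - 0ℤ - x) - (s - - x - (n - 1ℤ) * 0ℤ) ≡ n - + 2 - r - s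
    arith = solve-∀
    eliminate : δℤ i j ≡ 0ℤ → δℤ j i ≡ 0ℤ → w j i ≡ - w i j →
      (+ n - 1ℤ - rowSum i) - (1ℤ - δℤ i j - w i j) - (rowSum j - w j i - (+ n - 1ℤ) * δℤ j i)
        ≡ + n - + 2 - rowSum i - rowSum j
    eliminate δij≡0 δji≡0 wji≡-wij rewrite δij≡0 | δji≡0 | wji≡-wij = arith (+ n) (rowSum i) (rowSum j) (w i j)

  -- The entries of J − I − W are even, so the left side of ∑[J-I-W]²-rows is ≡ 0 (mod 4).
  rowSum-pair : + 4 ∣ℤ + n → ∀ {i j} → i ≢ j → + 4 ∣ℤ rowSum i + rowSum j + + 2
  rowSum-pair 4∣n {i} {j} i≢j = subst (+ 4 ∣ℤ_) n-∑≡Ri+Rj+2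
    (∣m∣n⇒∣m-n 4∣n (∑-divisible _ (λ k → *-pres-∣ (w-parity i k) (w-parity j k))))
    where
    simplify : ∀ n r s → n - (n - + 2 - r - s) ≡ r + s + + 2
    simplify = solve-∀
    n-∑≡Ri+Rj+2 : + n - ∑[ k < n ] ((1ℤ - δℤ i k - w i k) * (1ℤ - δℤ j k - w j k)) ≡ rowSum i + rowSum j + + 2
    n-∑≡Ri+Rj+2 = trans (cong (λ s → + n - s) (∑[J-I-W]²-rows i≢j)) (simplify (+ n) (rowSum i) (rowSum j))

  rowSum-mod4 : + 4 ∣ℤ + n → ∀ i j → + 4 ∣ℤ rowSum i - rowSum j
  rowSum-mod4 4∣n i j with i FinP.≟ j
  ... | yes refl = subst (+ 4 ∣ℤ_) (sym (ℤP.+-inverseʳ (rowSum i))) (divides 0ℤ refl)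
  ... | no  i≢j  = subst (+ 4 ∣ℤ_) (regroup (rowSum i) (rowSum j))
    (∣m∣n⇒∣m-n (rowSum-pair 4∣n i≢j) (*-monoʳ-∣ (+ 2) (rowSum-odd (∣-trans (divides (+ 2) refl) 4∣n) j)))
    where
    regroup : ∀ r s → r + s + + 2 - + 2 * (s + 1ℤ) ≡ r - s
    regroup = solve-∀

  u+u·w≡∑u-u·[J-I-W] : ∀ (u : Vector ℤ n) j →
    u j + (u ·ᶻ w) j ≡ sum u - ∑[ i < n ] (u i * (1ℤ - δℤ i j - w i j))
  u+u·w≡∑u-u·[J-I-W] u j = trans (simplify (sum u) (u j) ((u ·ᶻ w) j))
    (cong (λ s → sum u - s) (sym (·[J-I-M] w u j)))
    where
    simplify : ∀ s x y → x + y ≡ s - (s - x - y)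
    simplify = solve-∀

  ∑[u+u·w] : ∀ (u : Vector ℤ n) → ∑[ j < n ] (u j + (u ·ᶻ w) j) ≡ ∑[ i < n ] (u i * (rowSum i + 1ℤ))
  ∑[u+u·w] u = begin
    ∑[ j < n ] (u j + (u ·ᶻ w) j)                       ≡⟨ ∑-distrib-+ u (u ·ᶻ w) ⟩
    sum u + ∑[ j < n ] ∑[ i < n ] (u i * w i j)         ≡⟨ cong (λ s → sum u + s) (∑-comm (λ i j → u i * w i j)) ⟨
    sum u + ∑[ i < n ] ∑[ j < n ] (u i * w i j)         ≡⟨ cong (λ s → sum u + s) (sum-cong-≗ (λ i → ∑-*ˡ (u i) (w i))) ⟩
    sum u + ∑[ i < n ] (u i * rowSum i)                 ≡⟨ ∑-distrib-+ u (λ i → u i * rowSum i) ⟨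
    ∑[ i < n ] (u i + u i * rowSum i)                   ≡⟨ sum-cong-≗ (λ i → factor (u i) (rowSum i)) ⟩
    ∑[ i < n ] (u i * (rowSum i + 1ℤ))                  ∎
    where
    factor : ∀ x r → x + x * r ≡ x * (r + 1ℤ)
    factor = solve-∀

  ∑[u+u·w]-mod4 : + 4 ∣ℤ + n → Fin n → ∀ {u : Vector ℤ n} → + 2 ∣ℤ sum u →
    + 4 ∣ℤ ∑[ j < n ] (u j + (u ·ᶻ w) j)
  ∑[u+u·w]-mod4 4∣n r {u} 2∣Σu = subst (+ 4 ∣ℤ_) (sym (trans (∑[u+u·w] u) split))
    (∣m∣n⇒∣m+n (*-pres-∣ (rowSum-odd (∣-trans (divides (+ 2) refl) 4∣n) r) 2∣Σu)
                (∑-divisible _ (λ i → ∣n⇒∣m*n (u i) (rowSum-mod4 4∣n i r))))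
    where
    shift : ∀ x a b → x * (a + 1ℤ) ≡ (b + 1ℤ) * x + x * (a - b)
    shift = solve-∀
    split : ∑[ i < n ] (u i * (rowSum i + 1ℤ)) ≡ (rowSum r + 1ℤ) * sum u + ∑[ i < n ] (u i * (rowSum i - rowSum r))
    split = trans (sum-cong-≗ (λ i → shift (u i) (rowSum i) (rowSum r)))
      (trans (∑-distrib-+ (λ i → (rowSum r + 1ℤ) * u i) (λ i → u i * (rowSum i - rowSum r))) (cong (_+ ∑[ i < n ] (u i * (rowSum i - rowSum r))) (∑-*ˡ (rowSum r + 1ℤ) u)))

  halve[I+W] : + 4 ∣ℤ + n → Fin n → ∀ {u : Vector ℤ n} → + 2 ∣ℤ sum u →
    ∃ λ b → + 2 ∣ℤ sum b × (∀ j → u j + (u ·ᶻ w) j ≡ + 2 * b j)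
  halve[I+W] 4∣n r {u} 2∣Σu = b , 2∣Σb , u+u·w≡2b
    where
    2∣u+u·w : ∀ j → + 2 ∣ℤ u j + (u ·ᶻ w) j
    2∣u+u·w j = subst (+ 2 ∣ℤ_) (sym (u+u·w≡∑u-u·[J-I-W] u j))
      (∣m∣n⇒∣m-n 2∣Σu (∑-divisible _ (λ i → ∣n⇒∣m*n (u i) (w-parity i j))))
    b : Vector ℤ n
    b j = quotient (2∣u+u·w j)
    u+u·w≡2b : ∀ j → u j + (u ·ᶻ w) j ≡ + 2 * b j
    u+u·w≡2b j = trans (_∣ℤ_.equality (2∣u+u·w j)) (ℤP.*-comm (b j) (+ 2))
    2∣Σb : + 2 ∣ℤ sum b
    2∣Σb = *-cancelˡ-∣ (+ 2) {+ 2} (subst (+ 4 ∣ℤ_)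
      (trans (sum-cong-≗ u+u·w≡2b) (∑-*ˡ (+ 2) b)) (∑[u+u·w]-mod4 4∣n r 2∣Σu))

  w² : ∀ i j → (w i ·ᶻ w) j ≡ - ((+ n - 1ℤ) * δℤ i j)
  w² i j = begin
    ∑[ k < n ] (w i k * w k j)     ≡⟨ sum-cong-≗ (λ k → cong (w i k *_) (w-skew j k)) ⟩
    ∑[ k < n ] (w i k * - w j k)   ≡⟨ sum-cong-≗ (λ k → ℤP.neg-distribʳ-* (w i k) (w j k)) ⟨
    ∑[ k < n ] (- (w i k * w j k)) ≡⟨ ∑-neg (λ k → w i k * w j k) ⟩
    - ∑[ k < n ] (w i k * w j k)   ≡⟨ cong -_ (w-gram i j) ⟩
    - ((+ n - 1ℤ) * δℤ i j)        ∎

  -- τ ∈ {0, 1} selects c = (2τ − 1)e_r + e_r W: with r the first index, τ = 1 gives L₊ and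
  -- τ = 0 gives L₋. Lattice vectors v are handled through x = 2v, and In2L x says x ∈ ℤc + 2L₀.
  module Lattice (8∣n : + 8 ∣ℤ + n) (r : Fin n) (τ : ℤ) (τ-idem : τ * τ ≡ τ) where

    σ : ℤ
    σ = + 2 * τ - 1ℤ

    c : Vector ℤ n
    c j = σ * δℤ r j + w r j

    4∣n : + 4 ∣ℤ + n
    4∣n = ∣-trans (divides (+ 2) refl) 8∣n

    c-even : + 2 ∣ℤ sum c
    c-even = subst (+ 2 ∣ℤ_) (sym ∑c≡)
      (∣m∣n⇒∣m+n (∣m⇒∣m*n (τ - 1ℤ) (divides 1ℤ refl)) (rowSum-odd (∣-trans (divides (+ 2) refl) 4∣n) r))
      where
      regroup : ∀ τ R → (+ 2 * τ - 1ℤ) * 1ℤ + R ≡ + 2 * (τ - 1ℤ) + (R + 1ℤ)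
      regroup = solve-∀
      ∑c≡ : sum c ≡ + 2 * (τ - 1ℤ) + (rowSum r + 1ℤ)
      ∑c≡ = begin
        sum c                        ≡⟨ ∑-distrib-+ (λ j → σ * δℤ r j) (w r) ⟩
        ∑[ j < n ] (σ * δℤ r j) + rowSum r
          ≡⟨ cong (_+ rowSum r) (trans (∑-*ˡ σ (δℤ r)) (cong (σ *_) (∑-δ≡1 r))) ⟩
        σ * 1ℤ + rowSum r            ≡⟨ regroup τ (rowSum r) ⟩
        + 2 * (τ - 1ℤ) + (rowSum r + 1ℤ) ∎

    c+c·w : ∀ j → c j + (c ·ᶻ w) j ≡ + 2 * τ * c j - + n * δℤ r j
    c+c·w j = begin
      c j + (c ·ᶻ w) j
        ≡⟨ cong (λ s → c j + s) (·ᶻ-linear w σ 1ℤ (λ i → cong (λ s → σ * δℤ r i + s) (sym (ℤP.*-identityˡ (w r i)))) j) ⟩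
      c j + (σ * (δℤ r ·ᶻ w) j + 1ℤ * (w r ·ᶻ w) j)
        ≡⟨ cong₂ (λ s t → c j + (σ * s + 1ℤ * t)) (∑-δ r (λ i → w i j)) (w² r j) ⟩
      c j + (σ * w r j + 1ℤ * - ((+ n - 1ℤ) * δℤ r j))
        ≡⟨ expand τ (+ n) (δℤ r j) (w r j) ⟩
      + 2 * τ * c j - + n * δℤ r j + + 4 * (τ - τ * τ) * δℤ r j
        ≡⟨ cong (λ t → + 2 * τ * c j - + n * δℤ r j + + 4 * (τ - t) * δℤ r j) τ-idem ⟩
      + 2 * τ * c j - + n * δℤ r j + + 4 * (τ - τ) * δℤ r j
        ≡⟨ cancel (+ 2 * τ * c j - + n * δℤ r j) τ (δℤ r j) ⟩
      + 2 * τ * c j - + n * δℤ r j ∎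
      where
      expand : ∀ τ n d v →
        ((+ 2 * τ - 1ℤ) * d + v) + ((+ 2 * τ - 1ℤ) * v + 1ℤ * - ((n - 1ℤ) * d))
          ≡ + 2 * τ * ((+ 2 * τ - 1ℤ) * d + v) - n * d + + 4 * (τ - τ * τ) * d
      expand = solve-∀
      cancel : ∀ x τ d → x + + 4 * (τ - τ) * d ≡ x
      cancel = solve-∀

    In2L : Vector ℤ n → Set
    In2L x = ∃₂ λ t u → + 2 ∣ℤ sum u × (∀ j → x j ≡ t * c j + + 2 * u j)

    In2L-lin : ∀ a b {x y} → In2L x → In2L y → In2L (λ j → a * x j + b * y j)
    In2L-lin a b (t , u , 2∣Σu , x≡) (t′ , u′ , 2∣Σu′ , y≡) =
      a * t + b * t′ , (λ j → a * u j + b * u′ j) ,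
      subst (+ 2 ∣ℤ_) (sym (∑-linear a b u u′)) (∣m∣n⇒∣m+n (∣n⇒∣m*n a 2∣Σu) (∣n⇒∣m*n b 2∣Σu′)) ,
      λ j → trans (cong₂ (λ p q → a * p + b * q) (x≡ j) (y≡ j)) (regroup a b t t′ (c j) (u j) (u′ j))
      where
      regroup : ∀ a b t t′ c u u′ →
        a * (t * c + + 2 * u) + b * (t′ * c + + 2 * u′) ≡ (a * t + b * t′) * c + + 2 * (a * u + b * u′)
      regroup = solve-∀

    In2L-half : ∀ {x} → In2L x → ∃ λ y → In2L y × (∀ j → x j + (x ·ᶻ w) j ≡ + 2 * y j)
    In2L-half {x} (t , u , 2∣Σu , x≡) = y , (t * τ , b′ , 2∣Σb′ , λ j → refl) , x+x·w≡2y
      where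
      halved : ∃ λ b → + 2 ∣ℤ sum b × (∀ j → u j + (u ·ᶻ w) j ≡ + 2 * b j)
      halved = halve[I+W] 4∣n r 2∣Σu
      b : Vector ℤ n
      b = proj₁ halved
      m : ℤ
      m = quotient 8∣n
      -- The only use of 8 ∣ n: (n/4)·t·e_r has even coordinate sum.
      b′ : Vector ℤ n
      b′ j = b j - + 2 * m * t * δℤ r j
      y : Vector ℤ n
      y j = t * τ * c j + + 2 * b′ j

      2∣Σb′ : + 2 ∣ℤ sum b′
      2∣Σb′ = subst (+ 2 ∣ℤ_) (sym ∑b′≡) (∣m∣n⇒∣m-n (proj₁ (proj₂ halved)) (∣m⇒∣m*n t (∣m⇒∣m*n m (divides 1ℤ refl))))
        where
        ∑b′≡ : sum b′ ≡ sum b - + 2 * m * t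
        ∑b′≡ = trans (∑-distrib-- b (λ j → + 2 * m * t * δℤ r j)) (cong (λ s → sum b - s)
          (trans (∑-*ˡ (+ 2 * m * t) (δℤ r)) (trans (cong (+ 2 * m * t *_) (∑-δ≡1 r)) (ℤP.*-identityʳ (+ 2 * m * t)))))

      regroup : ∀ t c u cw uw → (t * c + + 2 * u) + (t * cw + + 2 * uw) ≡ t * (c + cw) + + 2 * (u + uw)
      regroup = solve-∀
      collect : ∀ t τ m c b d →
        t * (+ 2 * τ * c - m * + 8 * d) + + 2 * (+ 2 * b) ≡ + 2 * (t * τ * c + + 2 * (b - + 2 * m * t * d))
      collect = solve-∀

      x+x·w≡2y : ∀ j → x j + (x ·ᶻ w) j ≡ + 2 * y j
      x+x·w≡2y j = begin
        x j + (x ·ᶻ w) j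
          ≡⟨ cong₂ _+_ (x≡ j) (·ᶻ-linear w t (+ 2) x≡ j) ⟩
        (t * c j + + 2 * u j) + (t * (c ·ᶻ w) j + + 2 * (u ·ᶻ w) j)
          ≡⟨ regroup t (c j) (u j) ((c ·ᶻ w) j) ((u ·ᶻ w) j) ⟩
        t * (c j + (c ·ᶻ w) j) + + 2 * (u j + (u ·ᶻ w) j)
          ≡⟨ cong₂ (λ p q → t * p + + 2 * q) (c+c·w j) (proj₂ (proj₂ halved) j) ⟩
        t * (+ 2 * τ * c j - + n * δℤ r j) + + 2 * (+ 2 * b j)
          ≡⟨ cong (λ N → t * (+ 2 * τ * c j - N * δℤ r j) + + 2 * (+ 2 * b j)) (_∣ℤ_.equality 8∣n) ⟩
        t * (+ 2 * τ * c j - m * + 8 * δℤ r j) + + 2 * (+ 2 * b j)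
          ≡⟨ collect t τ m (c j) (b j) (δℤ r j) ⟩
        + 2 * y j ∎

    In2L-reduce : ∀ {x} → In2L x →
      ∃ λ u → + 2 ∣ℤ sum u × ((∀ j → x j ≡ + 2 * u j) ⊎ (∀ j → x j ≡ c j + + 2 * u j))
    In2L-reduce {x} (t , u , 2∣Σu , x≡) = u′ , 2∣Σu′ , reduce (even-or-odd t)
      where
      q : ℤ
      q = t /ℕ 2
      u′ : Vector ℤ n
      u′ j = q * c j + u j
      2∣Σu′ : + 2 ∣ℤ sum u′
      2∣Σu′ = subst (+ 2 ∣ℤ_) (sym (trans (∑-distrib-+ (λ j → q * c j) u) (cong (_+ sum u) (∑-*ˡ q c))))
        (∣m∣n⇒∣m+n (∣n⇒∣m*n q c-even) 2∣Σu)
      even-case : ∀ q c u → q * + 2 * c + + 2 * u ≡ + 2 * (q * c + u)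
      even-case = solve-∀
      odd-case : ∀ q c u → (1ℤ + q * + 2) * c + + 2 * u ≡ c + + 2 * (q * c + u)
      odd-case = solve-∀
      reduce : t ≡ q * + 2 ⊎ t ≡ 1ℤ + q * + 2 → (∀ j → x j ≡ + 2 * u′ j) ⊎ (∀ j → x j ≡ c j + + 2 * u′ j)
      reduce (inj₁ t≡2q)   = inj₁ λ j → trans (x≡ j) (trans (cong (λ s → s * c j + + 2 * u j) t≡2q) (even-case q (c j) (u j)))
      reduce (inj₂ t≡1+2q) = inj₂ λ j → trans (x≡ j) (trans (cong (λ s → s * c j + + 2 * u j) t≡1+2q) (odd-case q (c j) (u j)))

    module Cosets (W : Matℚ n) (W≡ιw : ∀ i j → W i j ≡ ι (w i j))
      (H : Vecℚ n) (H≡½c : ∀ j → H j ≡ half c j) where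

      L : Vecℚ n → Set
      L v = L₀ n v ⊎ L₀ n (v -V H)

      L′ : Vecℚ n → Set
      L′ v = ∃ λ x → In2L x × (∀ j → v j ≡ half x j)

      L⇒L′ : ∀ {v} → L v → L′ v
      L⇒L′ (inj₁ (u , v≡ιu , 2∣Σu)) =
        (λ j → + 2 * u j) ,
        (0ℤ , u , even-sum⇒∣ u 2∣Σu , λ j → sym (ℤP.+-identityˡ (+ 2 * u j))) ,
        λ j → trans (v≡ιu j) (sym (½*ι[2*] (u j)))
      L⇒L′ (inj₂ (u , v-H≡ιu , 2∣Σu)) =
        (λ j → c j + + 2 * u j) ,
        (1ℤ , u , even-sum⇒∣ u 2∣Σu , λ j → cong (_+ + 2 * u j) (sym (ℤP.*-identityˡ (c j)))) ,
        λ j → trans (sub≡⇒≡+ (v-H≡ιu j)) (trans (cong (ℚ._+ ι (u j)) (H≡½c j)) (sym (half[c+2u] c u j)))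

      L′⇒L : ∀ {v} → L′ v → L v
      L′⇒L {v} (x , x∈ , v≡½x) = fromReduced (In2L-reduce x∈)
        where
        fromReduced : (∃ λ u → + 2 ∣ℤ sum u × ((∀ j → x j ≡ + 2 * u j) ⊎ (∀ j → x j ≡ c j + + 2 * u j))) → L v
        fromReduced (u , 2∣Σu , inj₁ x≡2u) =
          inj₁ (u , (λ j → trans (v≡½x j) (trans (cong (λ s → ½ ℚ.* ι s) (x≡2u j)) (½*ι[2*] (u j)))) , ∣⇒even-sum u 2∣Σu)
        fromReduced (u , 2∣Σu , inj₂ x≡c+2u) =
          inj₂ (u , (λ j → ≡+⇒sub≡ (trans (v≡½x j) (trans (cong (λ s → ½ ℚ.* ι s) (x≡c+2u j))
                     (trans (half[c+2u] c u j) (cong (ℚ._+ ι (u j)) (sym (H≡½c j))))))) , ∣⇒even-sum u 2∣Σu)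

      L′-+ : ∀ {u v} → L′ u → L′ v → L′ (u +V v)
      L′-+ {u} {v} (x , x∈ , u≡½x) (y , y∈ , v≡½y) =
        (λ j → 1ℤ * x j + 1ℤ * y j) , In2L-lin 1ℤ 1ℤ x∈ y∈ , λ j → begin
          u j ℚ.+ v j                        ≡⟨ cong₂ ℚ._+_ (u≡½x j) (v≡½y j) ⟩
          half x j ℚ.+ half y j              ≡⟨ half-+ x y j ⟩
          half (λ k → x k + y k) j           ≡⟨ cong₂ (λ s t → ½ ℚ.* ι (s + t)) (ℤP.*-identityˡ (x j)) (ℤP.*-identityˡ (y j)) ⟨
          half (λ k → 1ℤ * x k + 1ℤ * y k) j ∎

      L′-act : ∀ a b {v} → L′ v → L′ (actO n W a b v)
      L′-act a b (x , x∈ , v≡½x) =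
        let y , y∈ , x+x·w≡2y = In2L-half x∈ in
        (λ j → a * x j + b * y j) , In2L-lin a b x∈ y∈ ,
        λ j → trans (actO-cong W a b v≡½x j) (actO-half W w W≡ιw {x} {y} x+x·w≡2y a b j)

      isOModule : IsOModule n W L
      isOModule =
        inj₁ ((λ _ → 0ℤ) , (λ _ → refl) , ∣⇒even-sum {n} (λ _ → 0ℤ) (divides 0ℤ (sum-replicate-zero n))) ,
        (λ u v Lu Lv → L′⇒L (L′-+ (L⇒L′ Lu) (L⇒L′ Lv))) ,
        (λ a b v Lv → L′⇒L (L′-act a b (L⇒L′ Lv)))

-- Integrality of the rational matrix W
module IntegralEntries {n : ℕ} (W : Matℚ (ℕ.suc n))
  (W-skew : ∀ i j → W j i ≡ ℚ.- W i j)
  (W-diag : ∀ i → W i i ≡ 0ℚ)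
  (W-off  : ∀ i j → ¬ (toℕ i ≡ toℕ j) → (W i j ≡ 1ℚ ⊎ W i j ≡ ℚ.- 1ℚ))
  (W-gram : ∀ i j → Σℚ (ℕ.suc n) (λ k → W i k ℚ.* W j k) ≡ (+ (ℕ.suc n ∸ 1) ℚ./ 1) ℚ.* δ i j)
  where

  w : Fin (ℕ.suc n) → Fin (ℕ.suc n) → ℤ
  w i j = ↥ W i j

  W≡ιw : ∀ i j → W i j ≡ ι (w i j)
  W≡ιw i j with i FinP.≟ j
  ... | yes refl rewrite W-diag i = refl
  ... | no  i≢j  = sym (ι-↥ (W-off i j (i≢j ∘ FinP.toℕ-injective)))

  w-skew : ∀ i j → w j i ≡ - w i j
  w-skew i j = trans (cong ↥_ (W-skew i j)) (ℚP.↥-neg (W i j))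

  w-parity : ∀ i j → + 2 ∣ℤ 1ℤ - δℤ i j - w i j
  w-parity i j with i FinP.≟ j
  ... | yes refl rewrite δℤ-diag i | W-diag i = divides 0ℤ refl
  ... | no  i≢j  rewrite δℤ-off i≢j with W-off i j (i≢j ∘ FinP.toℕ-injective)
  ...   | inj₁ W≡1  rewrite W≡1  = divides 0ℤ refl
  ...   | inj₂ W≡-1 rewrite W≡-1 = divides 1ℤ refl

  w-gram : ∀ i j → ∑[ k < ℕ.suc n ] (w i k * w j k) ≡ (+ ℕ.suc n - 1ℤ) * δℤ i j
  w-gram i j = ι-injective (begin
    ι (∑[ k < ℕ.suc n ] (w i k * w j k))        ≡⟨ Σℚ-ι (ℕ.suc n) (λ k → w i k * w j k) ⟨
    Σℚ (ℕ.suc n) (λ k → ι (w i k * w j k))      ≡⟨ Σℚ-cong (ℕ.suc n) (λ k → trans (ι-* (w i k) (w j k))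
                                                      (sym (cong₂ ℚ._*_ (W≡ιw i k) (W≡ιw j k)))) ⟩
    Σℚ (ℕ.suc n) (λ k → W i k ℚ.* W j k)        ≡⟨ W-gram i j ⟩
    ι (+ n) ℚ.* δ i j                          ≡⟨ cong (ι (+ n) ℚ.*_) (δ≡ιδℤ i j) ⟩
    ι (+ n) ℚ.* ι (δℤ i j)                     ≡⟨ ι-* (+ n) (δℤ i j) ⟨
    ι (+ n * δℤ i j)                           ∎)

  ½e₁·M : ∀ (M : Matℚ (ℕ.suc n)) j → (½ •V (e₁ ·M M)) j ≡ ½ ℚ.* M zero j
  ½e₁·M M j = cong (½ ℚ.*_) (Σℚ-e₁ n (λ i → M i j))

  ½e₁[I+W] : ∀ j → (½ •V (e₁ ·M (I (ℕ.suc n) +M W))) j ≡ half (λ k → 1ℤ * δℤ zero k + w zero k) j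
  ½e₁[I+W] j = trans (½e₁·M (I (ℕ.suc n) +M W) j) (cong (½ ℚ.*_) (begin
    δ zero j ℚ.+ W zero j                 ≡⟨ cong₂ ℚ._+_ (δ≡ιδℤ zero j) (W≡ιw zero j) ⟩
    ι (δℤ zero j) ℚ.+ ι (w zero j)        ≡⟨ ι-+ (δℤ zero j) (w zero j) ⟨
    ι (δℤ zero j + w zero j)              ≡⟨ cong (λ d → ι (d + w zero j)) (ℤP.*-identityˡ (δℤ zero j)) ⟨
    ι (1ℤ * δℤ zero j + w zero j)         ∎))

  ½e₁[-I+W] : ∀ j → (½ •V (e₁ ·M (((ℚ.- 1ℚ) •M I (ℕ.suc n)) +M W))) j ≡ half (λ k → -1ℤ * δℤ zero k + w zero k) j
  ½e₁[-I+W] j = trans (½e₁·M (((ℚ.- 1ℚ) •M I (ℕ.suc n)) +M W) j) (cong (½ ℚ.*_) (begin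
    ℚ.- 1ℚ ℚ.* δ zero j ℚ.+ W zero j          ≡⟨ cong₂ (λ d v → ℚ.- 1ℚ ℚ.* d ℚ.+ v) (δ≡ιδℤ zero j) (W≡ιw zero j) ⟩
    ι -1ℤ ℚ.* ι (δℤ zero j) ℚ.+ ι (w zero j)  ≡⟨ cong (ℚ._+ ι (w zero j)) (ι-* -1ℤ (δℤ zero j)) ⟨
    ι (-1ℤ * δℤ zero j) ℚ.+ ι (w zero j)      ≡⟨ ι-+ (-1ℤ * δℤ zero j) (w zero j) ⟨
    ι (-1ℤ * δℤ zero j + w zero j)            ∎))

-- Squarefreeness of n − 1 only makes 𝒪 the maximal order.
lemma3p2 : (n : ℕ) → 0 < n → 8 ∣ n → Squarefree (n ∸ 1) →
    (W : Matℚ n) → IsConferenceW n W →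
    IsOModule n W (L₊ n W) × IsOModule n W (L₋ n W)
lemma3p2 (ℕ.suc n) _ 8∣n _ W (W-skew , W-diag , W-off , W-gram) = Plus.isOModule , Minus.isOModule
  where
  open IntegralEntries W W-skew W-diag W-off W-gram
  open ConferenceMatrix w w-skew w-parity w-gram
  module Plus  = Lattice.Cosets (∣ᵤ⇒∣ 8∣n) zero 1ℤ refl W W≡ιw (½ •V (e₁ ·M (I (ℕ.suc n) +M W))) ½e₁[I+W]
  module Minus = Lattice.Cosets (∣ᵤ⇒∣ 8∣n) zero 0ℤ refl W W≡ιw (½ •V (e₁ ·M (((ℚ.- 1ℚ) •M I (ℕ.suc n)) +M W))) ½e₁[-I+W]
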